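{- Let $G$ be a finite abelian group and let $A_1,\dots,A_m$ be pairwise disjoint nonempty subsets of $G$ with sizes $k_1,\dots,k_m$. Then the collection is bimodal if and only if for each $j$ with $k_j>1$, the set $B_j=\bigcup_{i\neq j}A_i$ is a union of cosets of the subgroup $H_j$.
   Context: $G$ is written additively, $G^*=G\setminus\{0\}$. For $\delta\in G^*$, $N_j(\delta)=|\{(a,b): a\in A_j,\ b\in A_i \text{ for some } i\neq j,\ a-b=\delta\}|$. The collection is bimodal if $N_j(\delta)\in\{0,k_j\}$ for all $\delta\in G^*$ and all $j$. $H_j$ (the internal difference group of $A_j$) is the subgroup of $G$ generated by $\{g_1-g_2: g_1,g_2\in A_j,\ g_1\neq g_2\}$. -}

module Defs where

open import Level using (Level; _⊔_)
open import Algebra.Bundles using (AbelianGroup)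
open import Data.Nat using (ℕ)
open import Data.Fin using (Fin) renaming (_≟_ to _≟ᶠ_)
open import Data.List using (List; []; length; filter; concatMap; cartesianProduct; allFin)
open import Data.List.Relation.Unary.Any using (Any)
open import Data.Sum using (_⊎_)
open import Relation.Binary.PropositionalEquality using (_≡_)
open import Data.Product using (_×_; Σ; _,_; proj₁; proj₂; ∃)
open import Relation.Nullary using (¬_)
open import Relation.Nullary.Decidable using (¬?)
open import Relation.Binary using (Decidable)
import Data.List.Relation.Unary.Unique.Setoid as UniqueS
import Data.List.Membership.Setoid as MemS

module Setup {c ℓ : Level} (G : AbelianGroup c ℓ)
             (_≟_ : Decidable (AbelianGroup._≈_ G)) where
  open AbelianGroup G renaming (_∙_ to _+_; ε to 0#; _⁻¹ to -_)
  open MemS setoid using (_∈_)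

  Mem : Carrier → List Carrier → Set (c ⊔ ℓ)
  Mem x S = x ∈ S

  Finite : Set (c ⊔ ℓ)
  Finite = Σ (List Carrier) λ es → ∀ x → x ∈ es

  -- a subset of G is a duplicate-free (up to ≈) list of elements
  Unique : List Carrier → Set (c ⊔ ℓ)
  Unique = UniqueS.Unique setoid

  module Family {m : ℕ} (A : Fin m → List Carrier) where

    k : Fin m → ℕ
    k j = length (A j)

    B : Fin m → List Carrier
    B j = concatMap A (filter (λ i → ¬? (i ≟ᶠ j)) (allFin m))

    N : Fin m → Carrier → ℕ
    N j δ = length (filter (λ p → (proj₁ p - proj₂ p) ≟ δ)
                           (cartesianProduct (A j) (B j)))

    Bimodal : Set (c ⊔ ℓ)
    Bimodal = ∀ j δ → ¬ (δ ≈ 0#) → N j δ ≡ 0 ⊎ N j δ ≡ k j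

  data Generated (X : Carrier → Set (c ⊔ ℓ)) : Carrier → Set (c ⊔ ℓ) where
    gen  : ∀ {x} → X x → Generated X x
    zer  : Generated X 0#
    add  : ∀ {x y} → Generated X x → Generated X y → Generated X (x + y)
    neg  : ∀ {x} → Generated X x → Generated X (- x)
    resp : ∀ {x y} → x ≈ y → Generated X x → Generated X y

  Diffs : List Carrier → Carrier → Set (c ⊔ ℓ)
  Diffs S d = Σ Carrier λ g₁ → Σ Carrier λ g₂ →
                g₁ ∈ S × g₂ ∈ S × ¬ (g₁ ≈ g₂) × d ≈ (g₁ - g₂)

  InternalDiffGroup : List Carrier → Carrier → Set (c ⊔ ℓ)
  InternalDiffGroup S = Generated (Diffs S)

  UnionOfCosets : (H : Carrier → Set (c ⊔ ℓ)) → List Carrier → Set (c ⊔ ℓ)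
  UnionOfCosets H X = Σ (List Carrier) λ R → ∀ x →
    (x ∈ X → Σ Carrier λ r → r ∈ R × H (x - r)) ×
    ((Σ Carrier λ r → r ∈ R × H (x - r)) → x ∈ X)

module Submission where

-- For a ∈ A_j the pairs (a, b) with b ∈ B_j and a - b = δ are counted by
-- the indicator of "a - δ ∈ B_j" (B_j is duplicate-free), so N_j(δ) is the
-- number of a ∈ A_j with a - δ ∈ B_j.  A sum of indicators over A_j is 0 or
-- k_j exactly when the indicator is constant on A_j; hence the collection
-- is bimodal iff, for each j and δ ≠ 0, membership of a - δ in B_j does
-- not depend on a ∈ A_j.  Taking δ = a₂ - s with s ∈ B_j, this says that
-- B_j is closed under translation by every difference a₁ - a₂ of elements
-- of A_j, i.e. under the group H_j they generate; and a subset closed under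
-- translation by H_j is precisely a union of H_j-cosets.  When k_j ≤ 1
-- there are no such differences and closure is automatic, which is why the
-- coset condition is only required for k_j > 1.

open import Level using (Level; _⊔_)
open import Algebra.Bundles using (AbelianGroup)
open import Data.Nat as ℕ using (ℕ; suc; _≤_; _>_; s≤s; z≤n)
open import Data.Nat.Properties using (m+n≡0⇒n≡0; m≤n⇒m≤1+n; suc-injective; 1+n≰n; _≤?_; ≰⇒>)
open import Data.Nat.ListAction using (sum)
open import Data.Fin using (Fin) renaming (_≟_ to _≟ᶠ_)
open import Data.List using (List; []; _∷_; _++_; length; filter; map; concatMap; cartesianProduct; allFin)
import Data.List.Properties as ListProps
open import Data.List.Relation.Unary.Any using (Any; here; there; any?)
import Data.List.Relation.Unary.Any as Any
import Data.List.Relation.Unary.Any.Properties as AnyProps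
open import Data.List.Relation.Unary.All using (All; []; _∷_; tabulateₛ; lookupₛ)
import Data.List.Relation.Unary.All as All
open import Data.List.Relation.Unary.All.Properties using (¬Any⇒All¬; All¬⇒¬Any)
open import Data.List.Relation.Unary.AllPairs using (AllPairs; []; _∷_)
import Data.List.Relation.Unary.Unique.Setoid as UniqueSetoid
import Data.List.Relation.Unary.Unique.Setoid.Properties as UniqueSetoidProps
import Data.List.Relation.Unary.Unique.Propositional.Properties as UniquePropProps
import Data.List.Membership.Propositional as PropMembership
import Data.List.Membership.Propositional.Properties as PropMembershipProps
import Data.List.Membership.Setoid as SetoidMembership
import Data.List.Membership.Setoid.Properties as SetoidMembershipProps
open import Data.Product using (_×_; _,_; proj₁; proj₂)
open import Data.Sum using (_⊎_; inj₁; inj₂)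
import Data.Sum as Sum
open import Data.Empty using (⊥; ⊥-elim)
open import Relation.Nullary using (¬_; yes; no; Dec; contradiction)
open import Relation.Nullary.Decidable using (¬?)
open import Relation.Binary using (Decidable; Setoid)
open import Relation.Binary.PropositionalEquality using (_≡_; _≢_; module ≡-Reasoning)
import Relation.Binary.PropositionalEquality as ≡
open import Defs

module IndicatorSum {a p} {X : Set a} {P : X → Set p} (P? : ∀ x → Dec (P x))
                    (f : X → ℕ) (on : ∀ {x} → P x → f x ≡ 1)
                    (off : ∀ {x} → ¬ P x → f x ≡ 0) where

  sum-all : ∀ {xs} → All P xs → sum (map f xs) ≡ length xs
  sum-all []         = ≡.refl
  sum-all (px ∷ pxs) = ≡.cong₂ ℕ._+_ (on px) (sum-all pxs)

  sum-none : ∀ {xs} → All (λ x → ¬ P x) xs → sum (map f xs) ≡ 0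
  sum-none []           = ≡.refl
  sum-none (¬px ∷ ¬pxs) = ≡.cong₂ ℕ._+_ (off ¬px) (sum-none ¬pxs)

  sum≤length : ∀ xs → sum (map f xs) ≤ length xs
  sum≤length []       = z≤n
  sum≤length (x ∷ xs) with P? x
  ... | yes px  rewrite on px   = s≤s (sum≤length xs)
  ... | no  ¬px rewrite off ¬px = m≤n⇒m≤1+n (sum≤length xs)

  full-sum⇒all : ∀ xs → sum (map f xs) ≡ length xs → All P xs
  full-sum⇒all []       _ = []
  full-sum⇒all (x ∷ xs) full with P? x
  ... | yes px  rewrite on px   = px ∷ full-sum⇒all xs (suc-injective full)
  ... | no  ¬px rewrite off ¬px =
    contradiction (sum≤length xs) (≡.subst (λ n → ¬ n ≤ length xs) (≡.sym full) 1+n≰n)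

  some⇒sum≢0 : ∀ {xs} → Any P xs → sum (map f xs) ≢ 0
  some⇒sum≢0 (here px) rewrite on px = λ ()
  some⇒sum≢0 {x ∷ _} (there pxs) total≡0 =
    some⇒sum≢0 pxs (m+n≡0⇒n≡0 (f x) total≡0)

  extreme⇒uniform : ∀ {xs} → sum (map f xs) ≡ 0 ⊎ sum (map f xs) ≡ length xs →
                    Any P xs → All P xs
  extreme⇒uniform         (inj₁ total≡0) some = ⊥-elim (some⇒sum≢0 some total≡0)
  extreme⇒uniform {xs} (inj₂ full)     _    = full-sum⇒all xs full

  uniform⇒extreme : ∀ {xs} → (Any P xs → All P xs) →
                    sum (map f xs) ≡ 0 ⊎ sum (map f xs) ≡ length xs
  uniform⇒extreme {xs} uniform with any? P? xs
  ... | yes some = inj₂ (sum-all (uniform some))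
  ... | no  none = inj₁ (sum-none (¬Any⇒All¬ xs none))

module UniqueCount {a ℓ q} (S : Setoid a ℓ) {Q : Setoid.Carrier S → Set q}
                   (Q? : ∀ x → Dec (Q x))
                   (Q-functional : ∀ {y y'} → Q y → Q y' → Setoid._≈_ S y y') where
  open Setoid S using (_≈_)

  count-absent : ∀ {ys} → ¬ Any Q ys → length (filter Q? ys) ≡ 0
  count-absent {ys} none = ≡.cong length (ListProps.filter-none Q? (¬Any⇒All¬ ys none))

  unique-witness : ∀ {y ys} → Q y → All (λ z → ¬ y ≈ z) ys → ¬ Any Q ys
  unique-witness qy y≉ys = All¬⇒¬Any (All.map (λ y≉z qz → y≉z (Q-functional qy qz)) y≉ys)

  count-present : ∀ {ys} → UniqueSetoid.Unique S ys → Any Q ys → length (filter Q? ys) ≡ 1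
  count-present (y≉ys ∷ _) (here qy) =
    ≡.trans (≡.cong length (ListProps.filter-accept Q? qy))
          (≡.cong suc (count-absent (unique-witness qy y≉ys)))
  count-present (y≉ys ∷ unique) (there some) =
    ≡.trans (≡.cong length (ListProps.filter-reject Q? (λ qy → unique-witness qy y≉ys some)))
          (count-present unique some)

module _ {a b p} {X : Set a} {Y : Set b} {P : X × Y → Set p} (P? : ∀ z → Dec (P z)) where

  length-filter-row : ∀ x ys →
    length (filter P? (map (x ,_) ys)) ≡ length (filter (λ y → P? (x , y)) ys)
  length-filter-row x []       = ≡.refl
  length-filter-row x (y ∷ ys) with P? (x , y)
  ... | yes _ = ≡.cong suc (length-filter-row x ys)
  ... | no  _ = length-filter-row x ys

  length-filter-cartesianProduct : ∀ xs ys →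
    length (filter P? (cartesianProduct xs ys)) ≡
    sum (map (λ x → length (filter (λ y → P? (x , y)) ys)) xs)
  length-filter-cartesianProduct []       ys = ≡.refl
  length-filter-cartesianProduct (x ∷ xs) ys = begin
    length (filter P? (row ++ cartesianProduct xs ys))
      ≡⟨ ≡.cong length (ListProps.filter-++ P? row (cartesianProduct xs ys)) ⟩
    length (filter P? row ++ filter P? (cartesianProduct xs ys))
      ≡⟨ ListProps.length-++ (filter P? row) ⟩
    length (filter P? row) ℕ.+ length (filter P? (cartesianProduct xs ys))
      ≡⟨ ≡.cong₂ ℕ._+_ (length-filter-row x ys) (length-filter-cartesianProduct xs ys) ⟩
    sum (map (λ x → length (filter (λ y → P? (x , y)) ys)) (x ∷ xs)) ∎
    where
    open ≡-Reasoning
    row : List (X × Y)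
    row = map (x ,_) ys

module _ {a ℓ} (S : Setoid a ℓ) where
  open Setoid S
  open SetoidMembership S using (_∈_)

  short-list-members-≈ : ∀ {xs x y} → length xs ≤ 1 → x ∈ xs → y ∈ xs → x ≈ y
  short-list-members-≈ {_ ∷ []}    _         (here x≈z) (here y≈z) = trans x≈z (sym y≈z)
  short-list-members-≈ {_ ∷ _ ∷ _} (s≤s ())  _          _

  concatMap-unique : ∀ {i} {I : Set i} (f : I → List Carrier) →
    (∀ i → UniqueSetoid.Unique S (f i)) →
    (∀ i i' → i ≢ i' → ∀ x → x ∈ f i → x ∈ f i' → ⊥) →
    ∀ {is} → AllPairs _≢_ is → UniqueSetoid.Unique S (concatMap f is)
  concatMap-unique f unique disjoint {[]}     []             = []
  concatMap-unique f unique disjoint {i ∷ is} (i∉is ∷ distinct) =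
    UniqueSetoidProps.++⁺ S (unique i) (concatMap-unique f unique disjoint distinct) apart
    where
    apart : ∀ {x} → ¬ (x ∈ f i × x ∈ concatMap f is)
    apart {x} (x∈fi , x∈rest) with PropMembership.find (AnyProps.concatMap⁻ f x∈rest)
    ... | i' , i'∈is , x∈fi' = disjoint i i' (All.lookup i∉is i'∈is) x x∈fi x∈fi'

module Translation {c ℓ} (G : AbelianGroup c ℓ)
                   (_≟_ : Decidable (AbelianGroup._≈_ G)) where
  open AbelianGroup G renaming (_∙_ to _+_; ε to 0#; _⁻¹ to -_)
  open import Algebra.Properties.AbelianGroup G
    using (⁻¹-anti-homo‿-; ⁻¹-∙-comm; xyx⁻¹≈y; ε⁻¹≈ε; ⁻¹-involutive; x≈y⇒x∙y⁻¹≈ε)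
  open import Relation.Binary.Reasoning.Setoid setoid
  open SetoidMembership setoid using (_∈_)
  open Setup G _≟_ using (Generated; gen; zer; add; neg; resp; Diffs; InternalDiffGroup; UnionOfCosets)

  ∈-resp-≈ : ∀ {x y xs} → x ≈ y → x ∈ xs → y ∈ xs
  ∈-resp-≈ = SetoidMembershipProps.∈-resp-≈ setoid

  add-sub-cancel : ∀ r x → r + (x - r) ≈ x
  add-sub-cancel r x = trans (sym (assoc r x (- r))) (xyx⁻¹≈y r x)

  sub-sub-cancel : ∀ a z → a - (a - z) ≈ z
  sub-sub-cancel a z = trans (∙-congˡ (⁻¹-anti-homo‿- a z)) (add-sub-cancel a z)

  sub-telescope : ∀ x y z → (x - y) + (y - z) ≈ x - z
  sub-telescope x y z = begin
    (x - y) + (y - z)       ≈⟨ assoc x (- y) (y - z) ⟩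
    x + (- y + (y - z))     ≈⟨ ∙-congˡ (sym (assoc (- y) y (- z))) ⟩
    x + ((- y + y) - z)     ≈⟨ ∙-congˡ (∙-congʳ (inverseˡ y)) ⟩
    x + (0# - z)            ≈⟨ ∙-congˡ (identityˡ (- z)) ⟩
    x - z                   ∎

  sub≈⇒≈sub : ∀ {a b δ} → a - b ≈ δ → b ≈ a - δ
  sub≈⇒≈sub {a} {b} a-b≈δ = trans (sym (sub-sub-cancel a b)) (∙-congˡ (⁻¹-cong a-b≈δ))

  ≈sub⇒sub≈ : ∀ {a b δ} → b ≈ a - δ → a - b ≈ δ
  ≈sub⇒sub≈ {a} {b} {δ} b≈a-δ = trans (∙-congˡ (⁻¹-cong b≈a-δ)) (sub-sub-cancel a δ)

  sub-identity : ∀ r → r - 0# ≈ r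
  sub-identity r = trans (∙-congˡ ε⁻¹≈ε) (identityʳ r)

  sub-add : ∀ r x y → r - (x + y) ≈ (r - x) - y
  sub-add r x y = trans (∙-congˡ (sym (⁻¹-∙-comm x y))) (sym (assoc r (- x) (- y)))

  add-sub-comm : ∀ r h s → (r + h) - s ≈ (r - s) + h
  add-sub-comm r h s = begin
    (r + h) - s   ≈⟨ assoc r h (- s) ⟩
    r + (h - s)   ≈⟨ ∙-congˡ (comm h (- s)) ⟩
    r + (- s + h) ≈⟨ sym (assoc r (- s) h) ⟩
    (r - s) + h   ∎

  TranslationClosed : (Carrier → Set (c ⊔ ℓ)) → List Carrier → Set (c ⊔ ℓ)
  TranslationClosed H S = ∀ {h s} → H h → s ∈ S → s + h ∈ S

  generated-closed : ∀ {X S} → (∀ {x} → X x → X (- x)) →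
    TranslationClosed X S → TranslationClosed (Generated X) S
  generated-closed {X} {S} X-neg closed hh s∈S = proj₁ (both-ways hh s∈S)
    where
    both-ways : ∀ {h} → Generated X h → ∀ {s} → s ∈ S → s + h ∈ S × s - h ∈ S
    both-ways (gen x) s∈S = closed x s∈S , closed (X-neg x) s∈S
    both-ways zer {s} s∈S =
      ∈-resp-≈ (sym (identityʳ s)) s∈S , ∈-resp-≈ (sym (sub-identity s)) s∈S
    both-ways (add {x} {y} hx hy) {s} s∈S =
      ∈-resp-≈ (assoc s x y) (proj₁ (both-ways hy (proj₁ (both-ways hx s∈S)))) ,
      ∈-resp-≈ (sym (sub-add s x y)) (proj₂ (both-ways hy (proj₂ (both-ways hx s∈S))))
    both-ways (neg {x} hx) s∈S =
      proj₂ (both-ways hx s∈S) ,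
      ∈-resp-≈ (∙-congˡ (sym (⁻¹-involutive x))) (proj₁ (both-ways hx s∈S))
    both-ways (resp x≈y hx) s∈S =
      ∈-resp-≈ (∙-congˡ x≈y) (proj₁ (both-ways hx s∈S)) ,
      ∈-resp-≈ (∙-congˡ (⁻¹-cong x≈y)) (proj₂ (both-ways hx s∈S))

  unionOfCosets⇒closed : ∀ {X S} → UnionOfCosets (Generated X) S →
    TranslationClosed (Generated X) S
  unionOfCosets⇒closed (R , cosets) {h} {r} hh r∈S =
    let r₀ , r₀∈R , r-r₀∈H = proj₁ (cosets r) r∈S
    in proj₂ (cosets (r + h)) (r₀ , r₀∈R , resp (sym (add-sub-comm r h r₀)) (add r-r₀∈H hh))

  closed⇒unionOfCosets : ∀ {X S} → TranslationClosed (Generated X) S →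
    UnionOfCosets (Generated X) S
  closed⇒unionOfCosets {S = S} closed =
    S , λ x → (λ x∈S → x , x∈S , resp (sym (inverseʳ x)) zer)
            , (λ { (r , r∈S , x-r∈H) → ∈-resp-≈ (add-sub-cancel r x) (closed x-r∈H r∈S) })

  diffs-neg : ∀ {S d} → Diffs S d → Diffs S (- d)
  diffs-neg (g₁ , g₂ , g₁∈S , g₂∈S , g₁≉g₂ , d≈g₁-g₂) =
    g₂ , g₁ , g₂∈S , g₁∈S , (λ g₂≈g₁ → g₁≉g₂ (sym g₂≈g₁)) ,
    trans (⁻¹-cong d≈g₁-g₂) (⁻¹-anti-homo‿- g₁ g₂)

  diff-in-group : ∀ {S a a'} → a ∈ S → a' ∈ S → InternalDiffGroup S (a' - a)
  diff-in-group {a = a} {a'} a∈S a'∈S with a' ≟ a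
  ... | yes a'≈a = resp (sym (x≈y⇒x∙y⁻¹≈ε a'≈a)) zer
  ... | no  a'≉a = gen (a' , a , a'∈S , a∈S , a'≉a , refl)

module Bimodality {c ℓ} (G : AbelianGroup c ℓ)
                  (_≟_ : Decidable (AbelianGroup._≈_ G))
                  (m : ℕ) (A : Fin m → List (AbelianGroup.Carrier G))
                  (A-unique : ∀ j → Setup.Unique G _≟_ (A j))
                  (A-disjoint : ∀ i j → i ≢ j → ∀ x →
                     Setup.Mem G _≟_ x (A i) → Setup.Mem G _≟_ x (A j) → ⊥) where
  open AbelianGroup G renaming (_∙_ to _+_; ε to 0#; _⁻¹ to -_)
  open import Algebra.Properties.AbelianGroup G using (x∙y⁻¹≈ε⇒x≈y)
  open SetoidMembership setoid using (_∈_; find; lose)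
  open Setup G _≟_ using (gen; Diffs; InternalDiffGroup; UnionOfCosets)
  open Setup.Family G _≟_ A using (k; B; N; Bimodal)
  open Translation G _≟_

  B-unique : ∀ j → Setup.Unique G _≟_ (B j)
  B-unique j = concatMap-unique setoid A A-unique A-disjoint
    (UniquePropProps.filter⁺ (λ i → ¬? (i ≟ᶠ j)) (UniquePropProps.allFin⁺ m))

  A-B-disjoint : ∀ {j x} → x ∈ A j → x ∈ B j → ⊥
  A-B-disjoint {j} {x} x∈Aj x∈Bj with PropMembership.find (AnyProps.concatMap⁻ A x∈Bj)
  ... | i , i∈others , x∈Ai =
    A-disjoint i j (proj₂ (PropMembershipProps.∈-filter⁻ (λ i → ¬? (i ≟ᶠ j)) {xs = allFin m} i∈others))
      x x∈Ai x∈Aj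

  Hit : Fin m → Carrier → Carrier → Set (c ⊔ ℓ)
  Hit j δ a = a - δ ∈ B j

  hit? : ∀ j δ a → Dec (Hit j δ a)
  hit? j δ a = any? (λ b → (a - δ) ≟ b) (B j)

  hit-resp : ∀ {j δ a a'} → a ≈ a' → Hit j δ a → Hit j δ a'
  hit-resp a≈a' = ∈-resp-≈ (∙-congʳ a≈a')

  hits : Fin m → Carrier → Carrier → ℕ
  hits j δ a = length (filter (λ b → (a - b) ≟ δ) (B j))

  N≡sum-hits : ∀ j δ → N j δ ≡ sum (map (hits j δ) (A j))
  N≡sum-hits j δ = length-filter-cartesianProduct (λ p → (proj₁ p - proj₂ p) ≟ δ) (A j) (B j)

  -- since B_j is duplicate-free, hits is the indicator function of Hit
  module _ (j : Fin m) (δ : Carrier) where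
    private
      module Count a = UniqueCount setoid (λ b → (a - b) ≟ δ)
        (λ a-b≈δ a-b'≈δ → trans (sub≈⇒≈sub a-b≈δ) (sym (sub≈⇒≈sub a-b'≈δ)))

    hits-on : ∀ {a} → Hit j δ a → hits j δ a ≡ 1
    hits-on {a} hit = Count.count-present a (B-unique j) (Any.map (λ e → ≈sub⇒sub≈ (sym e)) hit)

    hits-off : ∀ {a} → ¬ Hit j δ a → hits j δ a ≡ 0
    hits-off {a} miss = Count.count-absent a (λ some → miss (Any.map (λ q → sym (sub≈⇒≈sub q)) some))

  Transfers : Fin m → Carrier → Set (c ⊔ ℓ)
  Transfers j δ = ∀ {a a'} → a ∈ A j → a' ∈ A j → Hit j δ a → Hit j δ a'

  module _ (j : Fin m) (δ : Carrier) where
    open IndicatorSum (hit? j δ) (hits j δ) (hits-on j δ) (hits-off j δ)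

    extreme⇒transfers : N j δ ≡ 0 ⊎ N j δ ≡ k j → Transfers j δ
    extreme⇒transfers extreme a∈Aj a'∈Aj hit =
      lookupₛ setoid hit-resp (extreme⇒uniform sum-extreme (lose hit-resp a∈Aj hit)) a'∈Aj
      where
      sum-extreme = Sum.map (≡.trans (≡.sym (N≡sum-hits j δ))) (≡.trans (≡.sym (N≡sum-hits j δ))) extreme

    transfers⇒extreme : Transfers j δ → N j δ ≡ 0 ⊎ N j δ ≡ k j
    transfers⇒extreme transfers =
      Sum.map (≡.trans (N≡sum-hits j δ)) (≡.trans (N≡sum-hits j δ)) (uniform⇒extreme everywhere)
      where
      everywhere : Any (Hit j δ) (A j) → All (Hit j δ) (A j)
      everywhere some = let a , a∈Aj , hit = find some
                        in tabulateₛ setoid (λ a'∈Aj → transfers a∈Aj a'∈Aj hit)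

  DiffClosed : Fin m → Set (c ⊔ ℓ)
  DiffClosed j = TranslationClosed (Diffs (A j)) (B j)

  -- Translating s ∈ B_j by a₁ - a₂ amounts to transferring the hit of a₂
  -- by δ = a₂ - s (nonzero, since A_j and B_j are disjoint) to a₁.
  transfers⇒diffClosed : ∀ j → (∀ δ → ¬ δ ≈ 0# → Transfers j δ) → DiffClosed j
  transfers⇒diffClosed j transfers {d} {s} (a₁ , a₂ , a₁∈Aj , a₂∈Aj , _ , d≈a₁-a₂) s∈Bj =
    ∈-resp-≈ a₁-δ≈s+d (transfers δ δ≉0 a₂∈Aj a₁∈Aj a₂-hit)
    where
    δ = a₂ - s
    δ≉0 : ¬ δ ≈ 0#
    δ≉0 δ≈0 = A-B-disjoint a₂∈Aj (∈-resp-≈ (sym (x∙y⁻¹≈ε⇒x≈y a₂ s δ≈0)) s∈Bj)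
    a₂-hit : Hit j δ a₂
    a₂-hit = ∈-resp-≈ (sym (sub-sub-cancel a₂ s)) s∈Bj
    a₁-δ≈s+d : a₁ - δ ≈ s + d
    a₁-δ≈s+d = begin
      a₁ - (a₂ - s)            ≈⟨ sym (sub-telescope a₁ a₂ (a₂ - s)) ⟩
      (a₁ - a₂) + (a₂ - δ)     ≈⟨ ∙-congˡ (sub-sub-cancel a₂ s) ⟩
      (a₁ - a₂) + s            ≈⟨ comm (a₁ - a₂) s ⟩
      s + (a₁ - a₂)            ≈⟨ ∙-congˡ (sym d≈a₁-a₂) ⟩
      s + d                    ∎
      where open import Relation.Binary.Reasoning.Setoid setoid

  -- If B_j is closed under H_j, a hit a - δ ∈ B_j moves to a' - δ by
  -- translating by a' - a ∈ H_j.
  closed⇒transfers : ∀ j δ → TranslationClosed (InternalDiffGroup (A j)) (B j) → Transfers j δ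
  closed⇒transfers j δ closed {a} {a'} a∈Aj a'∈Aj hit =
    ∈-resp-≈ shift (closed (diff-in-group a∈Aj a'∈Aj) hit)
    where
    shift : (a - δ) + (a' - a) ≈ a' - δ
    shift = trans (comm (a - δ) (a' - a)) (sub-telescope a' a δ)

  short⇒diffClosed : ∀ j → k j ≤ 1 → DiffClosed j
  short⇒diffClosed j short (a₁ , a₂ , a₁∈Aj , a₂∈Aj , a₁≉a₂ , _) _ =
    ⊥-elim (a₁≉a₂ (short-list-members-≈ setoid short a₁∈Aj a₂∈Aj))

  bimodal⇔diffClosed : (Bimodal → ∀ j → DiffClosed j) × ((∀ j → DiffClosed j) → Bimodal)
  bimodal⇔diffClosed =
    (λ bimodal j → transfers⇒diffClosed j (λ δ δ≉0 → extreme⇒transfers j δ (bimodal j δ δ≉0))) ,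
    (λ closed j δ _ → transfers⇒extreme j δ
                        (closed⇒transfers j δ (generated-closed diffs-neg (closed j))))

  bimodal⇒unionOfCosets : Bimodal → ∀ j → UnionOfCosets (InternalDiffGroup (A j)) (B j)
  bimodal⇒unionOfCosets bimodal j =
    closed⇒unionOfCosets (generated-closed diffs-neg (proj₁ bimodal⇔diffClosed bimodal j))

  unionOfCosets⇒bimodal : (∀ j → k j > 1 → UnionOfCosets (InternalDiffGroup (A j)) (B j)) →
                          Bimodal
  unionOfCosets⇒bimodal cosets = proj₂ bimodal⇔diffClosed diffClosed
    where
    diffClosed : ∀ j → DiffClosed j
    diffClosed j with k j ≤? 1
    ... | yes short = short⇒diffClosed j short
    ... | no  long  = λ d s∈Bj → unionOfCosets⇒closed (cosets j (≰⇒> long)) (gen d) s∈Bj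

mainTheorem10 : ∀ {c ℓ : Level} (G : AbelianGroup c ℓ)
    (_≟_ : Decidable (AbelianGroup._≈_ G)) →
    Setup.Finite G _≟_ →
    (m : ℕ) (A : Fin m → List (AbelianGroup.Carrier G)) →
    (∀ j → Setup.Unique G _≟_ (A j)) →
    (∀ j → ¬ (A j ≡ [])) →
    (∀ i j → ¬ (i ≡ j) → ∀ x →
      Setup.Mem G _≟_ x (A i) → Setup.Mem G _≟_ x (A j) → ⊥) →
    (Setup.Family.Bimodal G _≟_ A →
      ∀ j → Setup.Family.k G _≟_ A j > 1 →
        Setup.UnionOfCosets G _≟_ (Setup.InternalDiffGroup G _≟_ (A j))
          (Setup.Family.B G _≟_ A j))
    ×
    ((∀ j → Setup.Family.k G _≟_ A j > 1 →
        Setup.UnionOfCosets G _≟_ (Setup.InternalDiffGroup G _≟_ (A j))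
          (Setup.Family.B G _≟_ A j)) →
      Setup.Family.Bimodal G _≟_ A)
mainTheorem10 G _≟_ _ m A unique _ disjoint =
  (λ bimodal j _ → bimodal⇒unionOfCosets bimodal j) , unionOfCosets⇒bimodal
  where open Bimodality G _≟_ m A unique disjoint
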